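{- Let $\ell\geq 3$ and $n$ be positive integers. If $\mathcal{F}$ is a family of $3$-element subsets of $[n]$ that does not contain $\mathbb{C}^{(3)}_\ell$, then $|\mathcal{F}|\leq (2\ell-3)\binom{n}{2}$.
   Context: The $3$-uniform linear cycle $\mathbb{C}^{(3)}_\ell$ consists of triples $F_1,\dots,F_\ell$ and distinct vertices $v_1,\dots,v_\ell$ with $F_i\cap\{v_1,\dots,v_\ell\}=\{v_i,v_{i+1}\}$ (indices mod $\ell$) and the sets $F_i\setminus\{v_1,\dots,v_\ell\}$ pairwise disjoint. $\mathcal{F}$ contains $H$ if it has a subfamily isomorphic to $H$. -}

module Defs where

open import Data.Nat using (ℕ; zero; suc)
open import Data.Nat.DivMod using (_%_; m%n<n)
open import Data.Fin using (Fin; toℕ; fromℕ<; _<_)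
open import Data.List using (List)
open import Data.List.Membership.Propositional using (_∈_)
open import Data.Product using (Σ; ∃; _×_; _,_)
open import Data.Sum using (_⊎_)
open import Function using (_⇔_)
open import Function.Definitions using (Injective)
open import Relation.Binary.PropositionalEquality using (_≡_)
open import Relation.Nullary using (¬_)

-- A 3-element subset {a, b, c} of [n] = Fin n, stored in increasing order
-- (so two triples are equal iff they are the same 3-set).
record Triple (n : ℕ) : Set where
  constructor triple
  field
    a b c : Fin n
    a<b : a < b
    b<c : b < c

open Triple public

_∈ₜ_ : ∀ {n} → Fin n → Triple n → Set
x ∈ₜ t = x ≡ a t ⊎ x ≡ b t ⊎ x ≡ c t

next : ∀ {ℓ} → Fin ℓ → Fin ℓ
next {suc k} i = fromℕ< (m%n<n (suc (toℕ i)) (suc k))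

-- A family F contains the 3-uniform linear cycle C^(3)_ℓ:
-- there are pairwise distinct triples F₁,…,F_ℓ of the family and distinct
-- vertices v₁,…,v_ℓ with F_i ∩ {v_1..v_ℓ} = {v_i, v_{i+1}} and the sets
-- F_i ∖ {v_1..v_ℓ} pairwise disjoint.
ContainsLinearCycle : ∀ {n} → (ℓ : ℕ) → List (Triple n) → Set
ContainsLinearCycle {n} ℓ 𝓕 =
  Σ (Fin ℓ → Triple n) λ F → Σ (Fin ℓ → Fin n) λ v →
    Injective _≡_ _≡_ F ×
    Injective _≡_ _≡_ v ×
    (∀ i → F i ∈ 𝓕) ×
    (∀ i j → (v j ∈ₜ F i) ⇔ (j ≡ i ⊎ j ≡ next i)) ×
    (∀ i j → ¬ i ≡ j → ∀ x → x ∈ₜ F i → x ∈ₜ F j → ∃ λ k → x ≡ v k)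

module Submission where

-- Peeling: call a pair light in G if it lies in between 1 and d = 2ℓ − 3
-- triples of G. If every nonempty subfamily of 𝓕 has a light pair, deleting
-- the triples through one removes at most d triples and one pair of the
-- shadow, so |G| ≤ d·|∂G| ≤ d·(n choose 2) by induction on |∂G|.
-- Key lemma: if all pairs lying in triples of G have codegree ≥ 2ℓ − 2, G
-- contains the cycle. Escape lemma: the triples through uw have distinct
-- third vertices, so for uw inside a vertex list U with |U| < 2ℓ one of them
-- leaves U. From any triple we grow a linear path v₀ … v_k (private vertices
-- e_j) with a chord through v₀ and v_k: escaping from the chord yields v_{k+1}
-- and the next chord, escaping from v_k v_{k+1} yields e_k and the next triple;
-- at k = ℓ − 1 escaping from the chord once more closes the cycle.

open import Defs
import Data.Nat as ℕ
open import Data.Nat using (ℕ; zero; suc; _+_; _*_; _∸_; _≤_; _<_; _≥_; z≤n; s≤s)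
import Data.Nat.Properties as ℕP
open import Data.Nat.DivMod using (_%_; m<n⇒m%n≡m; n%n≡0)
open import Data.Nat.Combinatorics using (_C_; nC1≡n; nCk+nC[k+1]≡[n+1]C[k+1])
import Data.Fin as Fin
open import Data.Fin using (Fin; toℕ)
open import Data.Fin.Properties using (toℕ-injective; _≟_; <-irrelevant; toℕ-fromℕ<; toℕ<n)
open import Data.List using (List; []; _∷_; length; _++_; filter; map; allFin; upTo)
open import Data.List.Properties
  using (length-map; length-++; length-tabulate; length-upTo; length-filter; filter-≐)
open import Data.List.Membership.Propositional using (_∈_; _∉_; find; lose)
open import Data.List.Membership.Propositional.Properties
  using (∈-∃++; ∈-filter⁻; ∈-map⁻; ∈-map⁺; ∈-++⁺ˡ; ∈-++⁺ʳ; ∈-allFin; ∈-upTo⁺)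
open import Data.List.Relation.Binary.Subset.Propositional using (_⊆_)
import Data.List.Relation.Binary.Sublist.Propositional as Sublist
import Data.List.Relation.Binary.Sublist.Propositional.Properties as Sublist
open import Data.List.Relation.Unary.Any using (Any; here; there; any?)
import Data.List.Relation.Unary.Any.Properties as Any
open import Data.List.Relation.Unary.All using (All; []; _∷_; all?)
import Data.List.Relation.Unary.All as All
import Data.List.Relation.Unary.All.Properties as All
open import Data.List.Relation.Unary.All.Properties using (¬All⇒Any¬)
open import Data.List.Relation.Unary.Unique.Propositional using (Unique; []; _∷_)
open import Data.List.Relation.Unary.Unique.Propositional.Properties using (filter⁺)
open import Data.Product using (∃; _×_; _,_; proj₁; proj₂; swap)
open import Data.Sum using (_⊎_; inj₁; inj₂)
open import Data.Empty using (⊥-elim)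
open import Function using (_⇔_; mk⇔)
open import Relation.Binary using (tri<; tri≈; tri>)
open import Relation.Binary.PropositionalEquality
open import Relation.Nullary using (¬_; Dec; yes; no; contradiction)
open import Relation.Nullary.Decidable using (_×-dec_; ¬?)

module _ {A : Set} where

  ∈-delete : ∀ {x y : A} (ys zs : List A) → x ∈ ys ++ y ∷ zs → x ≢ y → x ∈ ys ++ zs
  ∈-delete []       zs (here x≡y) x≢y = contradiction x≡y x≢y
  ∈-delete []       zs (there x∈) _   = x∈
  ∈-delete (_ ∷ ys) zs (here x≡z) _   = here x≡z
  ∈-delete (_ ∷ ys) zs (there x∈) x≢y = there (∈-delete ys zs x∈ x≢y)

  length-delete : ∀ (ys zs : List A) {y : A} → length (ys ++ y ∷ zs) ≡ suc (length (ys ++ zs))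
  length-delete []       zs = refl
  length-delete (_ ∷ ys) zs = cong suc (length-delete ys zs)

  unique-⊆⇒length-≤ : ∀ (xs ys : List A) → Unique xs → (∀ {x} → x ∈ xs → x ∈ ys) →
    length xs ≤ length ys
  unique-⊆⇒length-≤ []       ys _             _   = z≤n
  unique-⊆⇒length-≤ (x ∷ xs) ys (x∉xs ∷ uxs) xs⊆ with ∈-∃++ (xs⊆ (here refl))
  ... | ys₁ , ys₂ , refl = ℕP.≤-trans
    (s≤s (unique-⊆⇒length-≤ xs (ys₁ ++ ys₂) uxs
      (λ x′∈ → ∈-delete ys₁ ys₂ (xs⊆ (there x′∈)) (λ x′≡x → All.lookup x∉xs x′∈ (sym x′≡x)))))
    (ℕP.≤-reflexive (sym (length-delete ys₁ ys₂)))

module _ {A B : Set} where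

  map-unique-on : (f : A → B) (xs : List A) → Unique xs →
    (∀ {x y} → x ∈ xs → y ∈ xs → f x ≡ f y → x ≡ y) → Unique (map f xs)
  map-unique-on f []       []           _     = []
  map-unique-on f (x ∷ xs) (x∉xs ∷ uxs) f-inj =
    All.map⁺ (All.tabulate λ y∈ fx≡fy → All.lookup x∉xs y∈ (f-inj (here refl) (there y∈) fx≡fy))
    ∷ map-unique-on f xs uxs (λ x∈ y∈ → f-inj (there x∈) (there y∈))

module _ {A : Set} where

  filter-complement : ∀ {P : A → Set} (P? : ∀ x → Dec (P x)) (xs : List A) →
    length (filter P? xs) + length (filter (λ x → ¬? (P? x)) xs) ≡ length xs
  filter-complement P? []       = refl
  filter-complement P? (x ∷ xs) with P? x
  ... | yes _ = cong suc (filter-complement P? xs)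
  ... | no _  = trans (ℕP.+-suc _ _) (cong suc (filter-complement P? xs))

  filter-mono : ∀ {P Q : A → Set} (P? : ∀ x → Dec (P x)) (Q? : ∀ x → Dec (Q x)) →
    (∀ {x} → P x → Q x) → (xs : List A) → length (filter P? xs) ≤ length (filter Q? xs)
  filter-mono P? Q? P⇒Q xs =
    Sublist.length-mono-≤ (Sublist.filter⁺ P? Q? (λ { refl → P⇒Q }) (Sublist.⊆-refl {x = xs}))

  filter-strict : ∀ {P Q : A → Set} (P? : ∀ x → Dec (P x)) (Q? : ∀ x → Dec (Q x)) →
    (∀ {x} → P x → Q x) → (xs : List A) → ∀ {y} → y ∈ xs → Q y → ¬ P y →
    length (filter P? xs) < length (filter Q? xs)
  filter-strict P? Q? P⇒Q (x ∷ xs) y∈ Qy ¬Py with P? x | Q? x | y∈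
  ... | yes Px | _     | here refl = ⊥-elim (¬Py Px)
  ... | no _   | no ¬Qx | here refl = ⊥-elim (¬Qx Qy)
  ... | no _   | yes _  | here refl = s≤s (filter-mono P? Q? P⇒Q xs)
  ... | yes Px | no ¬Qx | there _  = ⊥-elim (¬Qx (P⇒Q Px))
  ... | yes _  | yes _  | there y∈xs = s≤s (filter-strict P? Q? P⇒Q xs y∈xs Qy ¬Py)
  ... | no _   | yes _  | there y∈xs = ℕP.m≤n⇒m≤1+n (filter-strict P? Q? P⇒Q xs y∈xs Qy ¬Py)
  ... | no _   | no _   | there y∈xs = filter-strict P? Q? P⇒Q xs y∈xs Qy ¬Py

module _ {n : ℕ} where

  _∈ₜ?_ : (x : Fin n) (t : Triple n) → Dec (x ∈ₜ t)
  x ∈ₜ? t with x ≟ a t | x ≟ b t | x ≟ c t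
  ... | yes x≡a | _       | _       = yes (inj₁ x≡a)
  ... | no _    | yes x≡b | _       = yes (inj₂ (inj₁ x≡b))
  ... | no _    | no _    | yes x≡c = yes (inj₂ (inj₂ x≡c))
  ... | no x≢a  | no x≢b  | no x≢c  =
    no λ { (inj₁ x≡a) → x≢a x≡a ; (inj₂ (inj₁ x≡b)) → x≢b x≡b ; (inj₂ (inj₂ x≡c)) → x≢c x≡c }

  a∈ : (t : Triple n) → a t ∈ₜ t
  a∈ t = inj₁ refl

  b∈ : (t : Triple n) → b t ∈ₜ t
  b∈ t = inj₂ (inj₁ refl)

  c∈ : (t : Triple n) → c t ∈ₜ t
  c∈ t = inj₂ (inj₂ refl)

  a<c : (t : Triple n) → a t Fin.< c t
  a<c t = ℕP.<-trans (a<b t) (b<c t)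

  a≢b : (t : Triple n) → a t ≢ b t
  a≢b t a≡b = ℕP.<⇒≢ (a<b t) (cong toℕ a≡b)

  a≢c : (t : Triple n) → a t ≢ c t
  a≢c t a≡c = ℕP.<⇒≢ (a<c t) (cong toℕ a≡c)

  b≢c : (t : Triple n) → b t ≢ c t
  b≢c t b≡c = ℕP.<⇒≢ (b<c t) (cong toℕ b≡c)

  vertices : Triple n → List (Fin n)
  vertices t = a t ∷ b t ∷ c t ∷ []

  vertices-unique : (t : Triple n) → Unique (vertices t)
  vertices-unique t = (a≢b t ∷ a≢c t ∷ []) ∷ (b≢c t ∷ []) ∷ [] ∷ []

  ∈ₜ⇒∈vertices : ∀ {x} {t : Triple n} → x ∈ₜ t → x ∈ vertices t
  ∈ₜ⇒∈vertices (inj₁ x≡a)        = here x≡a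
  ∈ₜ⇒∈vertices (inj₂ (inj₁ x≡b)) = there (here x≡b)
  ∈ₜ⇒∈vertices (inj₂ (inj₂ x≡c)) = there (there (here x≡c))

  -- Three distinct vertices of a triple are all of its vertices
  -- (a fourth distinct one would contradict the pigeonhole principle).
  three-exhaust : (t : Triple n) {p q r : Fin n} → p ∈ₜ t → q ∈ₜ t → r ∈ₜ t →
    p ≢ q → p ≢ r → q ≢ r → ∀ {x} → x ∈ₜ t → x ≡ p ⊎ x ≡ q ⊎ x ≡ r
  three-exhaust t {p} {q} {r} p∈ q∈ r∈ p≢q p≢r q≢r {x} x∈ with x ≟ p | x ≟ q | x ≟ r
  ... | yes x≡p | _       | _       = inj₁ x≡p
  ... | no _    | yes x≡q | _       = inj₂ (inj₁ x≡q)
  ... | no _    | no _    | yes x≡r = inj₂ (inj₂ x≡r)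
  ... | no x≢p  | no x≢q  | no x≢r  = ⊥-elim (ℕP.1+n≰n
    (unique-⊆⇒length-≤ (x ∷ p ∷ q ∷ r ∷ []) (vertices t)
      ((x≢p ∷ x≢q ∷ x≢r ∷ []) ∷ (p≢q ∷ p≢r ∷ []) ∷ (q≢r ∷ []) ∷ [] ∷ []) four⊆))
    where
    four⊆ : ∀ {y} → y ∈ x ∷ p ∷ q ∷ r ∷ [] → y ∈ vertices t
    four⊆ (here refl)                         = ∈ₜ⇒∈vertices {t = t} x∈
    four⊆ (there (here refl))                 = ∈ₜ⇒∈vertices {t = t} p∈
    four⊆ (there (there (here refl)))         = ∈ₜ⇒∈vertices {t = t} q∈
    four⊆ (there (there (there (here refl)))) = ∈ₜ⇒∈vertices {t = t} r∈

  -- A triple is determined by its vertex set: its smallest, middle and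
  -- largest vertices are determined by the set.
  triple-ext : (t₁ t₂ : Triple n) → (∀ {x} → x ∈ₜ t₁ → x ∈ₜ t₂) → (∀ {x} → x ∈ₜ t₂ → x ∈ₜ t₁) →
    t₁ ≡ t₂
  triple-ext t₁@(triple a₁ b₁ c₁ a<b₁ b<c₁) t₂@(triple a₂ b₂ c₂ a<b₂ b<c₂) ⊆₁₂ ⊆₂₁
    with a-eq | c-eq | b-eq
    where
    a-least : (t : Triple n) {x : Fin n} → x ∈ₜ t → toℕ (a t) ≤ toℕ x
    a-least t (inj₁ refl)        = ℕP.≤-refl
    a-least t (inj₂ (inj₁ refl)) = ℕP.<⇒≤ (a<b t)
    a-least t (inj₂ (inj₂ refl)) = ℕP.<⇒≤ (a<c t)
    c-greatest : (t : Triple n) {x : Fin n} → x ∈ₜ t → toℕ x ≤ toℕ (c t)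
    c-greatest t (inj₁ refl)        = ℕP.<⇒≤ (a<c t)
    c-greatest t (inj₂ (inj₁ refl)) = ℕP.<⇒≤ (b<c t)
    c-greatest t (inj₂ (inj₂ refl)) = ℕP.≤-refl
    a-eq : a₁ ≡ a₂
    a-eq = toℕ-injective (ℕP.≤-antisym (a-least t₁ (⊆₂₁ (a∈ t₂))) (a-least t₂ (⊆₁₂ (a∈ t₁))))
    c-eq : c₁ ≡ c₂
    c-eq = toℕ-injective (ℕP.≤-antisym (c-greatest t₂ (⊆₁₂ (c∈ t₁))) (c-greatest t₁ (⊆₂₁ (c∈ t₂))))
    -- b₁ is a vertex of t₂ strictly between a₂ = a₁ and c₂ = c₁
    b-eq : b₁ ≡ b₂
    b-eq with ⊆₁₂ (b∈ t₁)
    ... | inj₁ b₁≡a₂        = ⊥-elim (ℕP.<-irrefl (cong toℕ (trans a-eq (sym b₁≡a₂))) a<b₁)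
    ... | inj₂ (inj₁ b₁≡b₂) = b₁≡b₂
    ... | inj₂ (inj₂ b₁≡c₂) = ⊥-elim (ℕP.<-irrefl (cong toℕ (trans b₁≡c₂ (sym c-eq))) b<c₁)
  ... | refl | refl | refl
    rewrite <-irrelevant a<b₁ a<b₂ | <-irrelevant b<c₁ b<c₂ = refl

-- Codegrees and the escape lemma.

module _ {n : ℕ} where

  open import Data.List.Membership.DecPropositional (_≟_ {n}) using (_∈?_)

  Through : Fin n → Fin n → Triple n → Set
  Through u w t = u ∈ₜ t × w ∈ₜ t

  through? : (u w : Fin n) (t : Triple n) → Dec (Through u w t)
  through? u w t = (u ∈ₜ? t) ×-dec (w ∈ₜ? t)

  codeg : List (Triple n) → Fin n → Fin n → ℕ
  codeg G u w = length (filter (through? u w) G)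

  codeg-comm : ∀ G (u w : Fin n) → codeg G u w ≡ codeg G w u
  codeg-comm G u w = cong length (filter-≐ (through? u w) (through? w u) (swap , swap) G)

  Avoids : Fin n → Fin n → Fin n → Set
  Avoids u w x = x ≢ u × x ≢ w

  avoids? : (u w x : Fin n) → Dec (Avoids u w x)
  avoids? u w x = ¬? (x ≟ u) ×-dec ¬? (x ≟ w)

  ¬avoids⇒∈ : ∀ {u w x : Fin n} → ¬ Avoids u w x → x ∈ u ∷ w ∷ []
  ¬avoids⇒∈ {u} {w} {x} ¬avoids with x ≟ u | x ≟ w
  ... | yes x≡u | _       = here x≡u
  ... | no _    | yes x≡w = there (here x≡w)
  ... | no x≢u  | no x≢w  = ⊥-elim (¬avoids (x≢u , x≢w))

  -- The first vertex of t other than u and w; it exists since t has three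
  -- vertices.
  third : Fin n → Fin n → Triple n → Fin n
  third u w t with avoids? u w (a t) | avoids? u w (b t)
  ... | yes _ | _     = a t
  ... | no _  | yes _ = b t
  ... | no _  | no _  = c t

  third-spec : (u w : Fin n) (t : Triple n) → third u w t ∈ₜ t × Avoids u w (third u w t)
  third-spec u w t with avoids? u w (a t) | avoids? u w (b t)
  ... | yes a-avoids | _            = a∈ t , a-avoids
  ... | no _         | yes b-avoids = b∈ t , b-avoids
  ... | no ¬a-avoids | no ¬b-avoids = c∈ t , (λ c≡u → c∉ (here c≡u)) , (λ c≡w → c∉ (there (here c≡w)))
    where
    -- otherwise all three vertices of t would lie in {u, w}
    c∉ : c t ∉ u ∷ w ∷ []
    c∉ c∈ = ℕP.1+n≰n (unique-⊆⇒length-≤ (vertices t) (u ∷ w ∷ []) (vertices-unique t) λ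
      { (here refl)                 → ¬avoids⇒∈ ¬a-avoids
      ; (there (here refl))         → ¬avoids⇒∈ ¬b-avoids
      ; (there (there (here refl))) → c∈ })

  third-injective : ∀ {u w : Fin n} → u ≢ w → {t₁ t₂ : Triple n} → Through u w t₁ → Through u w t₂ →
    third u w t₁ ≡ third u w t₂ → t₁ ≡ t₂
  third-injective {u} {w} u≢w {t₁} {t₂} (u∈₁ , w∈₁) (u∈₂ , w∈₂) same =
    triple-ext t₁ t₂
      (⊆-via {t₂} t₁ u∈₂ w∈₂ (subst (_∈ₜ t₂) (sym same) (proj₁ (third-spec u w t₂))) u∈₁ w∈₁)
      (⊆-via {t₁} t₂ u∈₁ w∈₁ (subst (_∈ₜ t₁) same (proj₁ (third-spec u w t₁))) u∈₂ w∈₂)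
    where
    -- the vertices of t are u, w and third u w t, all of which lie in t′
    ⊆-via : ∀ {t′} (t : Triple n) → u ∈ₜ t′ → w ∈ₜ t′ → third u w t ∈ₜ t′ → u ∈ₜ t → w ∈ₜ t →
      ∀ {x} → x ∈ₜ t → x ∈ₜ t′
    ⊆-via t u∈′ w∈′ y∈′ u∈ w∈ x∈ with third-spec u w t
    ... | y∈ , y≢u , y≢w
      with three-exhaust t u∈ w∈ y∈ u≢w (λ u≡y → y≢u (sym u≡y)) (λ w≡y → y≢w (sym w≡y)) x∈
    ...   | inj₁ refl        = u∈′
    ...   | inj₂ (inj₁ refl) = w∈′
    ...   | inj₂ (inj₂ refl) = y∈′

  record FreshTriple (G : List (Triple n)) (u w : Fin n) (U : List (Fin n)) : Set where
    field
      extension   : Triple n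
      extension∈G : extension ∈ G
      new         : Fin n
      u∈          : u ∈ₜ extension
      w∈          : w ∈ₜ extension
      new∈        : new ∈ₜ extension
      new∉U       : new ∉ U

  -- The third vertices of the triples of G through u and w are
  -- pairwise distinct and different from u and w; so if they all lie in a list
  -- U that contains u and w, the codegree is at most |U| − 2.
  codeg-bound : (G : List (Triple n)) → Unique G → {u w : Fin n} → u ≢ w → (U : List (Fin n)) →
    u ∈ U → w ∈ U → All (λ t → third u w t ∈ U) (filter (through? u w) G) →
    2 + codeg G u w ≤ length U
  codeg-bound G uG {u} {w} u≢w U u∈U w∈U thirds∈U =
    subst (λ k → 2 + k ≤ length U) (length-map (third u w) Gᵤᵥ)
      (unique-⊆⇒length-≤ B U B-unique B⊆U)
    where
    Gᵤᵥ : List (Triple n)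
    Gᵤᵥ = filter (through? u w) G
    B : List (Fin n)
    B = u ∷ w ∷ map (third u w) Gᵤᵥ
    through-of : ∀ {t} → t ∈ Gᵤᵥ → Through u w t
    through-of t∈ = proj₂ (∈-filter⁻ (through? u w) {xs = G} t∈)
    avoids : ∀ {y} → y ∈ map (third u w) Gᵤᵥ → Avoids u w y
    avoids y∈ with ∈-map⁻ (third u w) y∈
    ... | t , _ , refl = proj₂ (third-spec u w t)
    B-unique : Unique B
    B-unique = (u≢w ∷ All.tabulate (λ y∈ u≡y → proj₁ (avoids y∈) (sym u≡y)))
             ∷ All.tabulate (λ y∈ w≡y → proj₂ (avoids y∈) (sym w≡y))
             ∷ map-unique-on (third u w) Gᵤᵥ (filter⁺ (through? u w) uG)
                 (λ t∈ t′∈ → third-injective u≢w (through-of t∈) (through-of t′∈))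
    B⊆U : ∀ {y} → y ∈ B → y ∈ U
    B⊆U (here refl)         = u∈U
    B⊆U (there (here refl)) = w∈U
    B⊆U (there (there y∈)) with ∈-map⁻ (third u w) y∈
    ... | t , t∈ , refl = All.lookup thirds∈U t∈

  escape : (G : List (Triple n)) → Unique G → {u w : Fin n} → u ≢ w → (U : List (Fin n)) →
    u ∈ U → w ∈ U → length U < 2 + codeg G u w → FreshTriple G u w U
  escape G uG {u} {w} u≢w U u∈U w∈U large
    with all? (λ t → third u w t ∈? U) (filter (through? u w) G)
  ... | yes thirds∈U =
    ⊥-elim (ℕP.<⇒≱ large (codeg-bound G uG u≢w U u∈U w∈U thirds∈U))
  ... | no ¬thirds∈U with find (¬All⇒Any¬ (λ t → third u w t ∈? U) _ ¬thirds∈U)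
  ...   | t , t∈ , y∉U with ∈-filter⁻ (through? u w) {xs = G} t∈
  ...     | t∈G , (u∈t , w∈t) = record
    { extension = t ; extension∈G = t∈G ; new = third u w t ; u∈ = u∈t ; w∈ = w∈t
    ; new∈ = proj₁ (third-spec u w t) ; new∉U = y∉U }

toℕ-next-< : ∀ {ℓ} (i : Fin ℓ) → suc (toℕ i) < ℓ → toℕ (next i) ≡ suc (toℕ i)
toℕ-next-< {suc k} i 1+i<ℓ = trans (toℕ-fromℕ< _) (m<n⇒m%n≡m 1+i<ℓ)

toℕ-next-last : ∀ {ℓ} (i : Fin ℓ) → suc (toℕ i) ≡ ℓ → toℕ (next i) ≡ 0
toℕ-next-last {suc k} i 1+i≡ℓ = trans (toℕ-fromℕ< _) (trans (cong (_% suc k) 1+i≡ℓ) (n%n≡0 (suc k)))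

next≢ : ∀ {ℓ} → 2 ≤ ℓ → (i : Fin ℓ) → next i ≢ i
next≢ {ℓ} 2≤ℓ i next≡i with ℕP.m≤n⇒m<n∨m≡n (toℕ<n i)
... | inj₁ 1+i<ℓ = ℕP.1+n≢n (trans (sym (toℕ-next-< i 1+i<ℓ)) (cong toℕ next≡i))
... | inj₂ 1+i≡ℓ = ℕP.n≮n 1 (subst (2 ≤_) (trans (sym 1+i≡ℓ) (cong suc i≡0)) 2≤ℓ)
  where
  i≡0 : toℕ i ≡ 0
  i≡0 = trans (sym (cong toℕ next≡i)) (toℕ-next-last i 1+i≡ℓ)

-- A skeleton of a linear cycle: triples F i through v i, v (next i) and a
-- private vertex e i, where the v's and e's are pairwise distinct. Any such
-- skeleton is a linear cycle, because each F i consists of exactly these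
-- three vertices.
skeleton⇒cycle : ∀ {n ℓ} (𝓕 : List (Triple n)) (v e : Fin ℓ → Fin n) (F : Fin ℓ → Triple n) →
  2 ≤ ℓ → (∀ {i j} → v i ≡ v j → i ≡ j) → (∀ {i j} → e i ≡ e j → i ≡ j) → (∀ i j → v i ≢ e j) →
  (∀ i → F i ∈ 𝓕) → (∀ i → v i ∈ₜ F i) → (∀ i → v (next i) ∈ₜ F i) → (∀ i → e i ∈ₜ F i) →
  ContainsLinearCycle ℓ 𝓕
skeleton⇒cycle 𝓕 v e F 2≤ℓ v-inj e-inj v≢e F∈ v∈F v′∈F e∈F =
  F , v , F-inj , v-inj , F∈ , core-meets , private-parts
  where
  exactly : ∀ i {x} → x ∈ₜ F i → x ≡ v i ⊎ x ≡ v (next i) ⊎ x ≡ e i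
  exactly i = three-exhaust (F i) (v∈F i) (v′∈F i) (e∈F i)
    (λ vi≡vi′ → next≢ 2≤ℓ i (sym (v-inj vi≡vi′))) (v≢e i i) (v≢e (next i) i)

  F-inj : ∀ {i j} → F i ≡ F j → i ≡ j
  F-inj {i} {j} Fi≡Fj with exactly j (subst (e i ∈ₜ_) Fi≡Fj (e∈F i))
  ... | inj₁ ei≡vj        = ⊥-elim (v≢e j i (sym ei≡vj))
  ... | inj₂ (inj₁ ei≡vj′) = ⊥-elim (v≢e (next j) i (sym ei≡vj′))
  ... | inj₂ (inj₂ ei≡ej) = e-inj ei≡ej

  core-meets : ∀ i j → (v j ∈ₜ F i) ⇔ (j ≡ i ⊎ j ≡ next i)
  core-meets i j = mk⇔ to from
    where
    to : v j ∈ₜ F i → j ≡ i ⊎ j ≡ next i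
    to vj∈ with exactly i vj∈
    ... | inj₁ vj≡vi        = inj₁ (v-inj vj≡vi)
    ... | inj₂ (inj₁ vj≡vi′) = inj₂ (v-inj vj≡vi′)
    ... | inj₂ (inj₂ vj≡ei) = ⊥-elim (v≢e j i vj≡ei)
    from : j ≡ i ⊎ j ≡ next i → v j ∈ₜ F i
    from (inj₁ refl) = v∈F i
    from (inj₂ refl) = v′∈F i

  private-parts : ∀ i j → ¬ i ≡ j → ∀ x → x ∈ₜ F i → x ∈ₜ F j → ∃ λ k → x ≡ v k
  private-parts i j i≢j x x∈Fi x∈Fj with exactly i x∈Fi | exactly j x∈Fj
  ... | inj₁ x≡vi        | _                 = i , x≡vi
  ... | inj₂ (inj₁ x≡vi′) | _                 = next i , x≡vi′
  ... | inj₂ (inj₂ _)    | inj₁ x≡vj        = j , x≡vj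
  ... | inj₂ (inj₂ _)    | inj₂ (inj₁ x≡vj′) = next j , x≡vj′
  ... | inj₂ (inj₂ x≡ei) | inj₂ (inj₂ x≡ej) = ⊥-elim (i≢j (e-inj (trans (sym x≡ei) x≡ej)))

cycle-mono : ∀ {n ℓ} {G 𝓕 : List (Triple n)} → G ⊆ 𝓕 → ContainsLinearCycle ℓ G → ContainsLinearCycle ℓ 𝓕
cycle-mono G⊆𝓕 (F , v , F-inj , v-inj , F∈G , meets , private-parts) =
  F , v , F-inj , v-inj , (λ i → G⊆𝓕 (F∈G i)) , meets , private-parts

-- The vertices of a path under construction: core vertices v_j and extra
-- vertices e_j (the private vertex of the j-th triple).
data Slot : Set where
  core  : ℕ → Slot
  extra : ℕ → Slot

_≟ˢ_ : (p q : Slot) → Dec (p ≡ q)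
core i  ≟ˢ core j  with i ℕ.≟ j
... | yes refl = yes refl
... | no i≢j   = no λ { refl → i≢j refl }
extra i ≟ˢ extra j with i ℕ.≟ j
... | yes refl = yes refl
... | no i≢j   = no λ { refl → i≢j refl }
core _  ≟ˢ extra _ = no λ ()
extra _ ≟ˢ core _  = no λ ()

Filled : ℕ → Slot → Set
Filled k (core j)  = j ≤ k
Filled k (extra j) = j < k

core-unfilled : ∀ k → ¬ Filled k (core (suc k))
core-unfilled k = ℕP.1+n≰n

extra-unfilled : ∀ k → ¬ Filled k (extra k)
extra-unfilled k = ℕP.n≮n k

filled-suc : ∀ {k} q → Filled (suc k) q → (Filled k q ⊎ q ≡ core (suc k)) ⊎ q ≡ extra k
filled-suc (core j) j≤1+k with ℕP.m≤n⇒m<n∨m≡n j≤1+k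
... | inj₁ j<1+k  = inj₁ (inj₁ (ℕP.m<1+n⇒m≤n j<1+k))
... | inj₂ refl   = inj₁ (inj₂ refl)
filled-suc (extra j) j<1+k with ℕP.m<1+n⇒m<n∨m≡n j<1+k
... | inj₁ j<k  = inj₁ (inj₁ j<k)
... | inj₂ refl = inj₂ refl

InjectiveOn : {D A : Set} → (D → A) → (D → Set) → Set
InjectiveOn f P = ∀ {p q} → P p → P q → f p ≡ f q → p ≡ q

module _ {D A : Set} (_≟ᴰ_ : (p q : D) → Dec (p ≡ q)) where

  update : (D → A) → D → A → D → A
  update f p y q with q ≟ᴰ p
  ... | yes _ = y
  ... | no _  = f q

  update-same : ∀ f p y → update f p y p ≡ y
  update-same f p y with p ≟ᴰ p
  ... | yes _  = refl
  ... | no p≢p = ⊥-elim (p≢p refl)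

  update-other : ∀ f p y {q} → q ≢ p → update f p y q ≡ f q
  update-other f p y {q} q≢p with q ≟ᴰ p
  ... | yes q≡p = ⊥-elim (q≢p q≡p)
  ... | no _    = refl

  update-outside : ∀ (P : D → Set) f p y → ¬ P p → ∀ {q} → P q → update f p y q ≡ f q
  update-outside P f p y ¬Pp Pq = update-other f p y (λ { refl → ¬Pp Pq })

  update-injective : ∀ {P : D → Set} {f p y} → InjectiveOn f P → ¬ P p → (∀ {q} → P q → f q ≢ y) →
    InjectiveOn (update f p y) (λ q → P q ⊎ q ≡ p)
  update-injective {P} {f} {p} {y} inj ¬Pp fresh = go
    where
    agree : ∀ {q} → P q → update f p y q ≡ f q
    agree = update-outside P f p y ¬Pp
    go : InjectiveOn (update f p y) (λ q → P q ⊎ q ≡ p)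
    go (inj₁ Pq)   (inj₁ Pr)   eq = inj Pq Pr (trans (sym (agree Pq)) (trans eq (agree Pr)))
    go (inj₁ Pq)   (inj₂ refl) eq =
      ⊥-elim (fresh Pq (trans (sym (agree Pq)) (trans eq (update-same f p y))))
    go (inj₂ refl) (inj₁ Pr)   eq =
      ⊥-elim (fresh Pr (trans (sym (agree Pr)) (trans (sym eq) (update-same f p y))))
    go (inj₂ refl) (inj₂ refl) _  = refl

-- There are 2k + 1 filled vertices, fewer than 2ℓ as long as k < ℓ.
odd<double : ∀ {k ℓ} → k < ℓ → suc (k + k) < 2 * ℓ
odd<double {k} {ℓ} k<ℓ = begin-strict
  suc (k + k)      <⟨ s≤s (ℕP.+-monoʳ-< k (ℕP.n<1+n k)) ⟩
  suc (k + suc k)  ≤⟨ ℕP.+-mono-≤ k<ℓ k<ℓ ⟩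
  ℓ + ℓ            ≡⟨ cong (ℓ +_) (sym (ℕP.+-identityʳ ℓ)) ⟩
  2 * ℓ            ∎
  where open ℕP.≤-Reasoning

-- One more vertex still fits when k + 1 < ℓ.
even<double : ∀ {k ℓ} → suc k < ℓ → suc (suc (k + k)) < 2 * ℓ
even<double {k} {ℓ} 1+k<ℓ = begin-strict
  suc (suc (k + k))     ≡⟨ cong suc (sym (ℕP.+-suc k k)) ⟩
  suc (k + suc k)       <⟨ ℕP.n<1+n _ ⟩
  suc (suc k + suc k)   <⟨ odd<double 1+k<ℓ ⟩
  2 * ℓ                 ∎
  where open ℕP.≤-Reasoning

module _ {n : ℕ} where

  filledVertices : (Slot → Fin n) → ℕ → List (Fin n)
  filledVertices f k = map (λ j → f (core j)) (upTo (suc k)) ++ map (λ j → f (extra j)) (upTo k)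

  filled∈ : ∀ f {k q} → Filled k q → f q ∈ filledVertices f k
  filled∈ f {k} {core j}  j≤k = ∈-++⁺ˡ (∈-map⁺ (λ j → f (core j)) (∈-upTo⁺ (s≤s j≤k)))
  filled∈ f {k} {extra j} j<k = ∈-++⁺ʳ _ (∈-map⁺ (λ j → f (extra j)) (∈-upTo⁺ j<k))

  length-filled : ∀ f k → length (filledVertices f k) ≡ suc (k + k)
  length-filled f k = begin
    length (filledVertices f k)
      ≡⟨ length-++ (map (λ j → f (core j)) (upTo (suc k))) ⟩
    length (map (λ j → f (core j)) (upTo (suc k))) + length (map (λ j → f (extra j)) (upTo k))
      ≡⟨ cong₂ _+_ (trans (length-map _ (upTo (suc k))) (length-upTo (suc k)))
                   (trans (length-map _ (upTo k)) (length-upTo k)) ⟩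
    suc (k + k) ∎
    where open ≡-Reasoning

  fresh-vertex : ∀ f {k y} → y ∉ filledVertices f k → ∀ {q} → Filled k q → f q ≢ y
  fresh-vertex f y∉ Fq fq≡y = y∉ (subst (_∈ _) fq≡y (filled∈ f Fq))

  setCore : (Slot → Fin n) → ℕ → Fin n → Slot → Fin n
  setCore f k z = update _≟ˢ_ f (core (suc k)) z

  extendVertices : (Slot → Fin n) → ℕ → Fin n → Fin n → Slot → Fin n
  extendVertices f k z y = update _≟ˢ_ (setCore f k z) (extra k) y

  setCore-old : ∀ f {k} z {q} → Filled k q → setCore f k z q ≡ f q
  setCore-old f {k} z = update-outside _≟ˢ_ (Filled k) f (core (suc k)) z (core-unfilled k)

  extend-old : ∀ f {k} z y {q} → Filled k q → extendVertices f k z y q ≡ f q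
  extend-old f {k} z y Fq =
    trans (update-outside _≟ˢ_ (Filled k) (setCore f k z) (extra k) y (extra-unfilled k) Fq)
          (setCore-old f z Fq)

  extend-core : ∀ f k z y → extendVertices f k z y (core (suc k)) ≡ z
  extend-core f k z y = trans (update-other _≟ˢ_ (setCore f k z) (extra k) y {core (suc k)} (λ ()))
                              (update-same _≟ˢ_ f (core (suc k)) z)

  extend-extra : ∀ f k z y → extendVertices f k z y (extra k) ≡ y
  extend-extra f k z y = update-same _≟ˢ_ (setCore f k z) (extra k) y

  extend-extra-injective : ∀ {f k z y} → InjectiveOn f (Filled k) → (∀ {q} → Filled k q → f q ≢ y) →
    InjectiveOn (extendVertices f k z y) (λ q → Filled k q ⊎ q ≡ extra k)
  extend-extra-injective {f} {k} {z} {y} inj y-fresh =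
    update-injective _≟ˢ_ {P = Filled k} inj′ (extra-unfilled k)
      (λ Fq → subst (_≢ y) (sym (setCore-old f z Fq)) (y-fresh Fq))
    where
    inj′ : InjectiveOn (setCore f k z) (Filled k)
    inj′ Fp Fq eq = inj Fp Fq (trans (sym (setCore-old f z Fp)) (trans eq (setCore-old f z Fq)))

  extend-injective : ∀ {f k z y} → InjectiveOn f (Filled k) →
    (∀ {q} → Filled k q → f q ≢ z) → (∀ {q} → Filled k q → f q ≢ y) → z ≢ y →
    InjectiveOn (extendVertices f k z y) (Filled (suc k))
  extend-injective {f} {k} {z} {y} inj z-fresh y-fresh z≢y Fp Fq =
    update-injective _≟ˢ_ {P = λ q → Filled k q ⊎ q ≡ core (suc k)}
      (update-injective _≟ˢ_ {P = Filled k} inj (core-unfilled k) z-fresh)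
      extra-new y-fresh′ (filled-suc _ Fp) (filled-suc _ Fq)
    where
    extra-new : ¬ (Filled k (extra k) ⊎ extra k ≡ core (suc k))
    extra-new (inj₁ e<k) = extra-unfilled k e<k
    extra-new (inj₂ ())
    y-fresh′ : ∀ {q} → Filled k q ⊎ q ≡ core (suc k) → setCore f k z q ≢ y
    y-fresh′ (inj₁ Fq)   = subst (_≢ y) (sym (setCore-old f z Fq)) (y-fresh Fq)
    y-fresh′ (inj₂ refl) = subst (_≢ y) (sym (update-same _≟ˢ_ f (core (suc k)) z)) z≢y

module PathGrowth {n : ℕ} (G : List (Triple n)) where

  Spans : (Slot → Fin n) → Triple n → ℕ → Set
  Spans f t j = f (core j) ∈ₜ t × f (core (suc j)) ∈ₜ t × f (extra j) ∈ₜ t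

  record Path (k : ℕ) : Set where
    field
      vertex : Slot → Fin n
      edge   : ℕ → Triple n
      edge∈G : ∀ {j} → j < k → edge j ∈ G
      spans  : ∀ {j} → j < k → Spans vertex (edge j) j

  append : ∀ {k} (p : Path k) (z y : Fin n) (t : Triple n) → t ∈ G →
    Path.vertex p (core k) ∈ₜ t → z ∈ₜ t → y ∈ₜ t → Path (suc k)
  append {k} p z y t t∈G vₖ∈t z∈t y∈t = record
    { vertex = vertex′ ; edge = edge′ ; edge∈G = edge′∈G ; spans = spans′ }
    where
    open Path p
    vertex′ : Slot → Fin n
    vertex′ = extendVertices vertex k z y
    edge′ : ℕ → Triple n
    edge′ = update ℕ._≟_ edge k t
    old-edge : ∀ {j} → j < k → edge′ j ≡ edge j
    old-edge j<k = update-other ℕ._≟_ edge k t (ℕP.<⇒≢ j<k)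
    new-edge : edge′ k ≡ t
    new-edge = update-same ℕ._≟_ edge k t
    edge′∈G : ∀ {j} → j < suc k → edge′ j ∈ G
    edge′∈G j<1+k with ℕP.m<1+n⇒m<n∨m≡n j<1+k
    ... | inj₁ j<k  = subst (_∈ G) (sym (old-edge j<k)) (edge∈G j<k)
    ... | inj₂ refl = subst (_∈ G) (sym new-edge) t∈G
    old-spans : ∀ {j} → j < k → Spans vertex′ (edge′ j) j
    old-spans {j} j<k with spans j<k
    ... | vⱼ∈ , vⱼ₊₁∈ , eⱼ∈ = move (ℕP.<⇒≤ j<k) vⱼ∈ , move j<k vⱼ₊₁∈ , move j<k eⱼ∈
      where
      move : ∀ {q} → Filled k q → vertex q ∈ₜ edge j → vertex′ q ∈ₜ edge′ j
      move Fq q∈ = subst₂ _∈ₜ_ (sym (extend-old vertex z y Fq)) (sym (old-edge j<k)) q∈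
    new-spans : Spans vertex′ (edge′ k) k
    new-spans = subst (λ t′ → Spans vertex′ t′ k) (sym new-edge)
      ( subst (_∈ₜ t) (sym (extend-old vertex z y {core k} ℕP.≤-refl)) vₖ∈t
      , subst (_∈ₜ t) (sym (extend-core vertex k z y)) z∈t
      , subst (_∈ₜ t) (sym (extend-extra vertex k z y)) y∈t )
    spans′ : ∀ {j} → j < suc k → Spans vertex′ (edge′ j) j
    spans′ j<1+k with ℕP.m<1+n⇒m<n∨m≡n j<1+k
    ... | inj₁ j<k  = old-spans j<k
    ... | inj₂ refl = new-spans

  closed-path⇒cycle : ∀ {K} (p : Path (suc K)) → 1 ≤ K →
    InjectiveOn (Path.vertex p) (λ q → Filled K q ⊎ q ≡ extra K) →
    Path.vertex p (core (suc K)) ≡ Path.vertex p (core 0) →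
    ContainsLinearCycle (suc K) G
  closed-path⇒cycle {K} p 1≤K distinct closes =
    skeleton⇒cycle G v e F (s≤s 1≤K) v-inj e-inj v≢e F∈ v∈F v′∈F e∈F
    where
    open Path p

    Used : Slot → Set
    Used q = Filled K q ⊎ q ≡ extra K
    core-used : (i : Fin (suc K)) → Used (core (toℕ i))
    core-used i = inj₁ (ℕP.m<1+n⇒m≤n (toℕ<n i))
    extra-used : (i : Fin (suc K)) → Used (extra (toℕ i))
    extra-used i with ℕP.m<1+n⇒m<n∨m≡n (toℕ<n i)
    ... | inj₁ i<K = inj₁ i<K
    ... | inj₂ i≡K = inj₂ (cong extra i≡K)

    v e : Fin (suc K) → Fin n
    v i = vertex (core (toℕ i))
    e i = vertex (extra (toℕ i))
    F : Fin (suc K) → Triple n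
    F i = edge (toℕ i)

    index : Slot → ℕ
    index (core j)  = j
    index (extra j) = j
    v-inj : ∀ {i j} → v i ≡ v j → i ≡ j
    v-inj {i} {j} vi≡vj = toℕ-injective (cong index (distinct (core-used i) (core-used j) vi≡vj))
    e-inj : ∀ {i j} → e i ≡ e j → i ≡ j
    e-inj {i} {j} ei≡ej = toℕ-injective (cong index (distinct (extra-used i) (extra-used j) ei≡ej))
    v≢e : ∀ i j → v i ≢ e j
    v≢e i j vi≡ej with distinct (core-used i) (extra-used j) vi≡ej
    ... | ()

    F∈ : ∀ i → F i ∈ G
    F∈ i = edge∈G (toℕ<n i)
    v∈F : ∀ i → v i ∈ₜ F i
    v∈F i = proj₁ (spans (toℕ<n i))
    e∈F : ∀ i → e i ∈ₜ F i
    e∈F i = proj₂ (proj₂ (spans (toℕ<n i)))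
    -- v_{i+1} is v (next i), also for the last triple, where it is v₀
    wrap : ∀ i → vertex (core (suc (toℕ i))) ≡ v (next i)
    wrap i with ℕP.m<1+n⇒m<n∨m≡n (toℕ<n i)
    ... | inj₁ i<K = cong (λ j → vertex (core j)) (sym (toℕ-next-< i (s≤s i<K)))
    ... | inj₂ i≡K = begin
      vertex (core (suc (toℕ i)))   ≡⟨ cong (λ j → vertex (core (suc j))) i≡K ⟩
      vertex (core (suc K))         ≡⟨ closes ⟩
      vertex (core 0)
        ≡⟨ cong (λ j → vertex (core j)) (sym (toℕ-next-last i (cong suc i≡K))) ⟩
      vertex (core (toℕ (next i)))  ∎
      where open ≡-Reasoning
    v′∈F : ∀ i → v (next i) ∈ₜ F i
    v′∈F i = subst (_∈ₜ F i) (wrap i) (proj₁ (proj₂ (spans (toℕ<n i))))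

-- Finding a linear cycle in a family with large codegrees.

HighCodegree : ∀ {n} → ℕ → List (Triple n) → Set
HighCodegree {n} ℓ G = ∀ {u w : Fin n} → u ≢ w → ∀ {t} → t ∈ G → Through u w t → 2 * ℓ ≤ 2 + codeg G u w

module CycleConstruction {n : ℕ} (ℓ : ℕ) (G : List (Triple n)) (G-unique : Unique G)
  (high : HighCodegree ℓ G) where
  open PathGrowth G
  open FreshTriple

  -- The chord shows that v₀ v_k has
  -- large codegree, which lets the path grow and finally close up.
  record ChordedPath (k : ℕ) : Set where
    field
      path     : Path k
      distinct : InjectiveOn (Path.vertex path) (Filled k)
      chord    : Triple n
      chord∈G  : chord ∈ G
      ends∈    : Through (Path.vertex path (core 0)) (Path.vertex path (core k)) chord

  extend-pair : ∀ {u w t} → t ∈ G → Through u w t → u ≢ w → (U : List (Fin n)) →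
    u ∈ U → w ∈ U → length U < 2 * ℓ → FreshTriple G u w U
  extend-pair t∈G thr u≢w U u∈U w∈U short =
    escape G G-unique u≢w U u∈U w∈U (ℕP.<-≤-trans short (high u≢w t∈G thr))

  -- Any triple t of G is a chorded path of length one: v₀ = a, v₁ = c, e₀ = b.
  start : ∀ {t} → t ∈ G → ChordedPath 1
  start {t} t∈G = record
    { path = path₁
    ; distinct = extend-injective {f = λ _ → a t} single (λ { {core zero} _ → a≢c t })
                   (λ { {core zero} _ → a≢b t }) (λ c≡b → b≢c t (sym c≡b))
    ; chord = t ; chord∈G = t∈G
    ; ends∈ = subst (_∈ₜ t) (sym (extend-old (λ _ → a t) {0} (c t) (b t) {core 0} z≤n)) (a∈ t)
            , subst (_∈ₜ t) (sym (extend-core (λ _ → a t) 0 (c t) (b t))) (c∈ t) }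
    where
    path₀ : Path 0
    path₀ = record { vertex = λ _ → a t ; edge = λ _ → t ; edge∈G = λ () ; spans = λ () }
    path₁ : Path 1
    path₁ = append path₀ (c t) (b t) t t∈G (a∈ t) (c∈ t) (b∈ t)
    single : InjectiveOn (λ _ → a t) (Filled 0)
    single {core zero} {core zero} _ _ _ = refl

  module _ {k : ℕ} (P : ChordedPath (suc k)) where
    open ChordedPath P
    open Path path

    private
      K : ℕ
      K = suc k
      U : List (Fin n)
      U = filledVertices vertex K

    ends-distinct : vertex (core 0) ≢ vertex (core K)
    ends-distinct v₀≡vₖ with distinct {core 0} {core K} z≤n ℕP.≤-refl v₀≡vₖ
    ... | ()

    closing-triple : K < ℓ → FreshTriple G (vertex (core 0)) (vertex (core K)) U
    closing-triple K<ℓ = extend-pair chord∈G ends∈ ends-distinct U (filled∈ vertex {K} {core 0} z≤n)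
      (filled∈ vertex {K} {core K} ℕP.≤-refl)
      (subst (_< 2 * ℓ) (sym (length-filled vertex K)) (odd<double {K} K<ℓ))

    -- Growth step: the closing triple supplies the new end v_{K+1} and is the
    -- next chord; a triple through v_K v_{K+1} with a further new vertex e_K
    -- becomes the K-th triple of the path.
    step : suc K < ℓ → ChordedPath (suc K)
    step 1+K<ℓ = record
      { path = append path y₁ y₂ (extension f₂) (extension∈G f₂) (u∈ f₂) (w∈ f₂) (new∈ f₂)
      ; distinct = extend-injective distinct (fresh-vertex vertex (new∉U f₁))
                     (fresh-vertex vertex (λ y₂∈U → new∉U f₂ (there y₂∈U)))
                     (λ y₁≡y₂ → new∉U f₂ (here (sym y₁≡y₂)))
      ; chord = extension f₁ ; chord∈G = extension∈G f₁
      ; ends∈ = subst (_∈ₜ extension f₁) (sym (extend-old vertex {K} y₁ y₂ {core 0} z≤n)) (u∈ f₁)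
              , subst (_∈ₜ extension f₁) (sym (extend-core vertex K y₁ y₂)) (new∈ f₁) }
      where
      f₁ : FreshTriple G (vertex (core 0)) (vertex (core K)) U
      f₁ = closing-triple (ℕP.<-trans (ℕP.n<1+n K) 1+K<ℓ)
      y₁ : Fin n
      y₁ = new f₁
      f₂ : FreshTriple G (vertex (core K)) y₁ (y₁ ∷ U)
      f₂ = extend-pair (extension∈G f₁) (w∈ f₁ , new∈ f₁)
        (fresh-vertex vertex (new∉U f₁) {core K} ℕP.≤-refl) (y₁ ∷ U)
        (there (filled∈ vertex {K} {core K} ℕP.≤-refl)) (here refl)
        (subst (λ m → suc m < 2 * ℓ) (sym (length-filled vertex K)) (even<double {K} 1+K<ℓ))
      y₂ : Fin n
      y₂ = new f₂

    -- Closing: the closing triple, with v₀ in the role of v_{K+1}, becomes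
    -- the K-th triple, and the resulting closed path is a linear cycle.
    close : K < ℓ → ContainsLinearCycle (suc K) G
    close K<ℓ = closed-path⇒cycle cyc (s≤s z≤n)
      (extend-extra-injective distinct (fresh-vertex vertex (new∉U f)))
      (trans (extend-core vertex K v₀ (new f)) (sym (extend-old vertex {K} v₀ (new f) {core 0} z≤n)))
      where
      v₀ : Fin n
      v₀ = vertex (core 0)
      f : FreshTriple G v₀ (vertex (core K)) U
      f = closing-triple K<ℓ
      cyc : Path (suc K)
      cyc = append path v₀ (new f) (extension f) (extension∈G f) (w∈ f) (u∈ f) (new∈ f)

  grow : ∀ {t} → t ∈ G → ∀ k → suc k < ℓ → ChordedPath (suc k)
  grow t∈G zero    _     = start t∈G
  grow t∈G (suc k) 2+k<ℓ = step (grow t∈G k (ℕP.<-trans (ℕP.n<1+n _) 2+k<ℓ)) 2+k<ℓ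

  high-codegree⇒cycle : 2 ≤ ℓ → ∀ {t} → t ∈ G → ContainsLinearCycle ℓ G
  high-codegree⇒cycle 2≤ℓ t∈G with ℕP.m≤n⇒∃[o]m+o≡n 2≤ℓ
  ... | k , 2+k≡ℓ = subst (λ m → ContainsLinearCycle m G) 2+k≡ℓ
    (close (grow t∈G k (ℕP.≤-reflexive 2+k≡ℓ)) (ℕP.≤-reflexive 2+k≡ℓ))

withZero : ∀ {n} → Fin n → Fin (suc n) × Fin (suc n)
withZero j = Fin.zero , Fin.suc j

shift : ∀ {n} → Fin n × Fin n → Fin (suc n) × Fin (suc n)
shift (i , j) = Fin.suc i , Fin.suc j

orderedPairs : (n : ℕ) → List (Fin n × Fin n)
orderedPairs zero    = []
orderedPairs (suc n) = map withZero (allFin n) ++ map shift (orderedPairs n)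

length-orderedPairs : ∀ n → length (orderedPairs n) ≡ n C 2
length-orderedPairs zero    = refl
length-orderedPairs (suc n) = begin
  length (map withZero (allFin n) ++ map shift (orderedPairs n))
    ≡⟨ length-++ (map withZero (allFin n)) ⟩
  length (map withZero (allFin n)) + length (map shift (orderedPairs n))
    ≡⟨ cong₂ _+_ (trans (length-map withZero (allFin n)) (length-tabulate (λ i → i)))
                 (trans (length-map shift (orderedPairs n)) (length-orderedPairs n)) ⟩
  n + n C 2
    ≡⟨ cong (_+ n C 2) (sym (nC1≡n n)) ⟩
  n C 1 + n C 2
    ≡⟨ nCk+nC[k+1]≡[n+1]C[k+1] n 1 ⟩
  suc n C 2 ∎
  where open ≡-Reasoning

∈-orderedPairs : ∀ {n} (i j : Fin n) → toℕ i < toℕ j → (i , j) ∈ orderedPairs n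
∈-orderedPairs Fin.zero (Fin.suc j) _ = ∈-++⁺ˡ (∈-map⁺ withZero (∈-allFin j))
∈-orderedPairs {suc n} (Fin.suc i) (Fin.suc j) i<j =
  ∈-++⁺ʳ (map withZero (allFin n)) (∈-map⁺ shift (∈-orderedPairs i j (ℕP.≤-pred i<j)))

-- Shadows and peeling off light pairs.

module _ {n : ℕ} where

  InShadow : List (Triple n) → Fin n × Fin n → Set
  InShadow G (u , w) = Any (Through u w) G

  inShadow? : (G : List (Triple n)) → ∀ p → Dec (InShadow G p)
  inShadow? G (u , w) = any? (through? u w) G

  shadowSize : List (Triple n) → ℕ
  shadowSize G = length (filter (inShadow? G) (orderedPairs n))

  shadowSize≤ : ∀ G → shadowSize G ≤ n C 2
  shadowSize≤ G =
    subst (shadowSize G ≤_) (length-orderedPairs n) (length-filter (inShadow? G) (orderedPairs n))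

  Light : ℕ → List (Triple n) → Fin n × Fin n → Set
  Light d G (u , w) = InShadow G (u , w) × codeg G u w ≤ d

  light? : ∀ d G p → Dec (Light d G p)
  light? d G (u , w) = inShadow? G (u , w) ×-dec (codeg G u w ℕ.≤? d)

  misses? : (u w : Fin n) (t : Triple n) → Dec (¬ Through u w t)
  misses? u w t = ¬? (through? u w t)

  avoiding : Fin n → Fin n → List (Triple n) → List (Triple n)
  avoiding u w G = filter (misses? u w) G

  length-avoiding : ∀ u w G → length G ≡ codeg G u w + length (avoiding u w G)
  length-avoiding u w G = sym (filter-complement (through? u w) G)

  -- Deleting the triples through a shadow pair uw removes uw from the shadow
  -- and creates no new shadow pairs.
  shadow-shrinks : ∀ {u w} G → (u , w) ∈ orderedPairs n → InShadow G (u , w) →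
    shadowSize (avoiding u w G) < shadowSize G
  shadow-shrinks {u} {w} G uw∈ uw∈∂G =
    filter-strict (inShadow? (avoiding u w G)) (inShadow? G) (Any.filter⁻ _)
      (orderedPairs n) uw∈ uw∈∂G gone
    where
    gone : ¬ InShadow (avoiding u w G) (u , w)
    gone through-uw with find through-uw
    ... | t , t∈ , thr = proj₂ (∈-filter⁻ (misses? u w) {xs = G} t∈) thr

  peeling : (d : ℕ) (𝓕 : List (Triple n)) →
    (∀ {G} → Unique G → G ⊆ 𝓕 → ∀ {t} → t ∈ G → Any (Light d G) (orderedPairs n)) →
    ∀ {G} → Unique G → G ⊆ 𝓕 → length G ≤ d * shadowSize G
  peeling d 𝓕 light {G} uG G⊆𝓕 = peel (shadowSize G) G ℕP.≤-refl uG G⊆𝓕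
    where
    peel : ∀ s G → shadowSize G ≤ s → Unique G → G ⊆ 𝓕 → length G ≤ d * shadowSize G
    peel s []           _ _  _    = z≤n
    peel s G@(_ ∷ _) ∂G≤s uG G⊆𝓕 with find (light uG G⊆𝓕 (here refl))
    ... | (u , w) , uw∈ , (uw∈∂G , codeg≤d) = peel-at s ∂G≤s
      where
      G′ : List (Triple n)
      G′ = avoiding u w G
      shrinks : shadowSize G′ < shadowSize G
      shrinks = shadow-shrinks G uw∈ uw∈∂G
      G′-unique : Unique G′
      G′-unique = filter⁺ (misses? u w) uG
      G′⊆𝓕 : G′ ⊆ 𝓕
      G′⊆𝓕 t∈ = G⊆𝓕 (proj₁ (∈-filter⁻ (misses? u w) {xs = G} t∈))
      peel-at : ∀ s → shadowSize G ≤ s → length G ≤ d * shadowSize G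
      peel-at zero    ∂G≤0   = ⊥-elim (ℕP.n≮0 (ℕP.<-≤-trans shrinks ∂G≤0))
      peel-at (suc s) ∂G≤1+s = begin
        length G                 ≡⟨ length-avoiding u w G ⟩
        codeg G u w + length G′  ≤⟨ ℕP.+-mono-≤ codeg≤d (peel s G′ ∂G′≤s G′-unique G′⊆𝓕) ⟩
        d + d * shadowSize G′    ≡⟨ sym (ℕP.*-suc d (shadowSize G′)) ⟩
        d * suc (shadowSize G′)  ≤⟨ ℕP.*-monoʳ-≤ d shrinks ⟩
        d * shadowSize G         ∎
        where
        open ℕP.≤-Reasoning
        ∂G′≤s : shadowSize G′ ≤ s
        ∂G′≤s = ℕP.≤-pred (ℕP.<-≤-trans shrinks ∂G≤1+s)

  no-light⇒heavy-ordered : ∀ {d G} → ¬ Any (Light d G) (orderedPairs n) →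
    ∀ {u w : Fin n} → toℕ u < toℕ w → ∀ {t} → t ∈ G → Through u w t → d < codeg G u w
  no-light⇒heavy-ordered {d} {G} ¬light {u} {w} u<w t∈G thr with codeg G u w ℕ.≤? d
  ... | yes codeg≤d = ⊥-elim (¬light (lose (∈-orderedPairs u w u<w) (lose t∈G thr , codeg≤d)))
  ... | no codeg≰d  = ℕP.≰⇒> codeg≰d

  no-light⇒heavy : ∀ {d G} → ¬ Any (Light d G) (orderedPairs n) →
    ∀ {u w : Fin n} → u ≢ w → ∀ {t} → t ∈ G → Through u w t → d < codeg G u w
  no-light⇒heavy {d} {G} ¬light {u} {w} u≢w t∈G (u∈ , w∈) with ℕP.<-cmp (toℕ u) (toℕ w)
  ... | tri< u<w _ _ = no-light⇒heavy-ordered ¬light u<w t∈G (u∈ , w∈)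
  ... | tri≈ _ u≡w _ = ⊥-elim (u≢w (toℕ-injective u≡w))
  ... | tri> _ _ w<u = subst (d <_) (codeg-comm G w u) (no-light⇒heavy-ordered ¬light w<u t∈G (w∈ , u∈))

above-threshold : ∀ {ℓ c} → 2 ≤ ℓ → 2 * ℓ ∸ 3 < c → 2 * ℓ ≤ 2 + c
above-threshold {ℓ} {c} 2≤ℓ d<c = begin
  2 * ℓ                ≡⟨ sym (ℕP.m∸n+n≡m 3≤2ℓ) ⟩
  2 * ℓ ∸ 3 + 3        ≡⟨ ℕP.+-suc (2 * ℓ ∸ 3) 2 ⟩
  suc (2 * ℓ ∸ 3) + 2  ≤⟨ ℕP.+-monoˡ-≤ 2 d<c ⟩
  c + 2                ≡⟨ ℕP.+-comm c 2 ⟩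
  2 + c                ∎
  where
  open ℕP.≤-Reasoning
  3≤2ℓ : 3 ≤ 2 * ℓ
  3≤2ℓ = ℕP.≤-trans (ℕP.n≤1+n 3) (ℕP.*-monoʳ-≤ 2 2≤ℓ)

-- If 𝓕 has no linear cycle of length ℓ ≥ 2, every nonempty duplicate-free
-- subfamily G has a light pair for d = 2ℓ − 3: otherwise all codegrees in
-- G would be at least 2ℓ − 2, and G would contain such a cycle.
light-pair-exists : ∀ {n ℓ} {𝓕 : List (Triple n)} → 2 ≤ ℓ → ¬ ContainsLinearCycle ℓ 𝓕 →
  ∀ {G} → Unique G → G ⊆ 𝓕 → ∀ {t} → t ∈ G → Any (Light (2 * ℓ ∸ 3) G) (orderedPairs n)
light-pair-exists {n} {ℓ} 2≤ℓ no-cycle {G} uG G⊆𝓕 t∈G with any? (light? (2 * ℓ ∸ 3) G) (orderedPairs n)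
... | yes light = light
... | no ¬light =
  ⊥-elim (no-cycle (cycle-mono G⊆𝓕 (CycleConstruction.high-codegree⇒cycle ℓ G uG high 2≤ℓ t∈G)))
  where
  high : HighCodegree ℓ G
  high u≢w t′∈G thr = above-threshold 2≤ℓ (no-light⇒heavy ¬light u≢w t′∈G thr)

proposition4p2 : (ℓ n : ℕ) → ℓ ≥ 3 → n ≥ 1 →
    (𝓕 : List (Triple n)) → Unique 𝓕 →
    ¬ ContainsLinearCycle ℓ 𝓕 →
    length 𝓕 ≤ (2 * ℓ ∸ 3) * (n C 2)
proposition4p2 ℓ n ℓ≥3 _ 𝓕 𝓕-unique no-cycle = begin
  length 𝓕                  ≤⟨ peeling d 𝓕 (light-pair-exists 2≤ℓ no-cycle) 𝓕-unique (λ t∈ → t∈) ⟩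
  d * shadowSize 𝓕          ≤⟨ ℕP.*-monoʳ-≤ d (shadowSize≤ 𝓕) ⟩
  d * (n C 2)               ∎
  where
  open ℕP.≤-Reasoning
  d : ℕ
  d = 2 * ℓ ∸ 3
  2≤ℓ : 2 ≤ ℓ
  2≤ℓ = ℕP.≤-trans (ℕP.n≤1+n 2) ℓ≥3
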